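{- Let $w\in\Sigma^*$ be a word of length at least $2$. If the circular word $\langle w\rangle$ is square-free, then every circumnavigation of $\langle w\rangle$ is square-free.
   Context: A word is square-free if it has no factor $xx$ with $x$ nonempty. Words $u,v$ are conjugates if $u=xy$, $v=yx$ for some words $x,y$. The circular word $\langle w\rangle$ is the set of conjugates of $w$; it is square-free if every conjugate of $w$ is square-free. A circumnavigation of $\langle w\rangle$ is a (linear) word of the form $ava$, where $a$ is a letter and $av$ is a conjugate of $w$. -}

module Defs where

open import Data.List using (List; []; _∷_; _++_; [_]; length)
open import Data.Product using (Σ; ∃; _×_; _,_)
open import Data.Nat using (ℕ; _≤_)
open import Relation.Binary.PropositionalEquality using (_≡_; _≢_)
open import Relation.Nullary using (¬_)

HasSquare : {A : Set} → List A → Set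
HasSquare {A} w = Σ (List A) λ p → Σ (List A) λ x → Σ (List A) λ s →
  (x ≢ []) × (w ≡ p ++ x ++ x ++ s)

SquareFree : {A : Set} → List A → Set
SquareFree w = ¬ HasSquare w

Conjugate : {A : Set} → List A → List A → Set
Conjugate {A} u v = Σ (List A) λ x → Σ (List A) λ y → (u ≡ x ++ y) × (v ≡ y ++ x)

-- The circular word ⟨w⟩ is square-free: every conjugate of w is square-free.
CircSquareFree : {A : Set} → List A → Set
CircSquareFree {A} w = (v : List A) → Conjugate w v → SquareFree v

Circumnavigation : {A : Set} → List A → List A → Set
Circumnavigation {A} w c = Σ A λ a → Σ (List A) λ v →
  Conjugate w (a ∷ v) × (c ≡ a ∷ (v ++ [ a ]))

module Submission where

-- Let c = a v a be a circumnavigation of ⟨w⟩, so u = a v is a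
-- conjugate of w, and suppose c = p x x s with x nonempty.  Either the square
-- avoids the last letter of c (then it lies in the prefix a v = u), or it
-- avoids the first letter (then it lies in the suffix v a, a rotation of u),
-- or it covers all of c.  In the last case x = y b and u = y b y, so u has the
-- conjugate y y b, which contains the square y y unless y is empty, i.e.
-- unless |u| = 1 — excluded since |u| = |w| ≥ 2.  In every other case a
-- conjugate of a conjugate of w contains a square, contradicting
-- square-freeness of ⟨w⟩ because conjugacy is transitive.

open import Defs
open import Data.List using (List; []; _∷_; _++_; [_]; length; initLast; _∷ʳ′_)
open import Data.List.Properties
  using (++-assoc; ++-identityʳ; length-++-comm; ∷-injective; ∷-injectiveʳ; ∷ʳ-injective)
open import Data.Nat using (_≤_)
open import Data.Nat.Properties using (<-irrefl)
open import Data.Product using (Σ; _×_; _,_; proj₁)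
open import Data.Sum using (_⊎_; inj₁; inj₂)
open import Data.Empty using (⊥-elim)
open import Relation.Binary.PropositionalEquality
  using (_≡_; _≢_; refl; sym; trans; cong; subst; module ≡-Reasoning)

private
  variable
    A : Set

++-equidivisible : (Y X P Q : List A) → Y ++ X ≡ P ++ Q →
  (Σ (List A) λ m → (Y ≡ P ++ m) × (Q ≡ m ++ X)) ⊎
  (Σ (List A) λ m → (P ≡ Y ++ m) × (X ≡ m ++ Q))
++-equidivisible Y       X []      Q eq = inj₁ (Y , refl , sym eq)
++-equidivisible []      X (p ∷ P) Q eq = inj₂ (p ∷ P , refl , eq)
++-equidivisible (y ∷ Y) X (p ∷ P) Q eq with ∷-injective eq
... | refl , eq′ with ++-equidivisible Y X P Q eq′
...   | inj₁ (m , refl , Q≡mX) = inj₁ (m , refl , Q≡mX)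
...   | inj₂ (m , refl , X≡mQ) = inj₂ (m , refl , X≡mQ)

-- Conjugacy is transitive; with Levi's lemma the two cuts combine into one.
conjugate-trans : {u v t : List A} → Conjugate u v → Conjugate v t → Conjugate u t
conjugate-trans (X , Y , refl , refl) (P , Q , YX≡PQ , refl)
  with ++-equidivisible Y X P Q YX≡PQ
... | inj₁ (m , refl , refl) =
  X ++ P , m , sym (++-assoc X P m) , ++-assoc m X P
... | inj₂ (m , refl , refl) =
  m , Q ++ Y , ++-assoc m Q Y , sym (++-assoc Q Y m)

conjugate-length : {u v : List A} → Conjugate u v → length u ≡ length v
conjugate-length (X , Y , refl , refl) = length-++-comm X Y

rotate-left : (a : A) (v : List A) → Conjugate (a ∷ v) (v ++ [ a ])
rotate-left a v = [ a ] , v , refl , refl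

IsSquare : List A → Set
IsSquare {A} w = Σ (List A) λ x → (x ≢ []) × (w ≡ x ++ x)

square-position : (a b : A) (m : List A) → HasSquare (a ∷ m ++ [ b ]) →
  HasSquare (a ∷ m) ⊎ HasSquare (m ++ [ b ]) ⊎ IsSquare (a ∷ m ++ [ b ])
square-position a b m (p , x , s , x≢[] , eq) with initLast s
... | s′ ∷ʳ′ b′ =
  inj₁ (p , x , s′ , x≢[] , proj₁ (∷ʳ-injective (a ∷ m) (p ++ x ++ x ++ s′) dropLast))
  where
    open ≡-Reasoning
    dropLast : (a ∷ m) ++ [ b ] ≡ (p ++ x ++ x ++ s′) ++ [ b′ ]
    dropLast = begin
      a ∷ m ++ [ b ]                  ≡⟨ eq ⟩
      p ++ x ++ x ++ s′ ++ [ b′ ]     ≡⟨ cong (λ r → p ++ x ++ r) (++-assoc x s′ [ b′ ]) ⟨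
      p ++ x ++ (x ++ s′) ++ [ b′ ]   ≡⟨ cong (p ++_) (++-assoc x (x ++ s′) [ b′ ]) ⟨
      p ++ (x ++ x ++ s′) ++ [ b′ ]   ≡⟨ ++-assoc p (x ++ x ++ s′) [ b′ ] ⟨
      (p ++ x ++ x ++ s′) ++ [ b′ ]   ∎
... | [] with p
...   | a′ ∷ p′ = inj₂ (inj₁ (p′ , x , [] , x≢[] , ∷-injectiveʳ eq))
...   | []      = inj₂ (inj₂ (x , x≢[] , trans eq (cong (x ++_) (++-identityʳ x))))

-- A word of the form y b y with y nonempty has the conjugate y y b, which
-- begins with the square y y.
split-square : (y : List A) (b : A) {u : List A} → u ≡ (y ++ [ b ]) ++ y →
  length u ≡ 1 ⊎ (Σ (List A) λ t → Conjugate u t × HasSquare t)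
split-square []       b u≡b    = inj₁ (cong length u≡b)
split-square (c ∷ y′) b u≡yby =
  inj₂ (_ , (c ∷ y′ ++ [ b ] , c ∷ y′ , u≡yby , refl) , ([] , c ∷ y′ , [ b ] , (λ ()) , refl))

-- If u b is a square y b y b, then u = y b y; so either u has length 1 or
-- some conjugate of u contains a square.
square-rotation : (u : List A) (b : A) → IsSquare (u ++ [ b ]) →
  length u ≡ 1 ⊎ (Σ (List A) λ t → Conjugate u t × HasSquare t)
square-rotation u b (x , x≢[] , eq) with initLast x
... | [] = ⊥-elim (x≢[] refl)
... | y ∷ʳ′ b′ = split-square y b′ (proj₁ (∷ʳ-injective u ((y ++ [ b′ ]) ++ y) regroup))
  where
    open ≡-Reasoning
    regroup : u ++ [ b ] ≡ ((y ++ [ b′ ]) ++ y) ++ [ b′ ]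
    regroup = begin
      u ++ [ b ]                          ≡⟨ eq ⟩
      (y ++ [ b′ ]) ++ (y ++ [ b′ ])      ≡⟨ ++-assoc (y ++ [ b′ ]) y [ b′ ] ⟨
      ((y ++ [ b′ ]) ++ y) ++ [ b′ ]      ∎

lemma10 : {A : Set} (w : List A) → 2 ≤ length w → CircSquareFree w →
    (c : List A) → Circumnavigation w c → SquareFree c
lemma10 w 2≤|w| csf c (a , v , w~av , refl) square
  with square-position a a v square
... | inj₁ inPrefix = csf (a ∷ v) w~av inPrefix
... | inj₂ (inj₁ inSuffix) = csf (v ++ [ a ]) (conjugate-trans w~av (rotate-left a v)) inSuffix
... | inj₂ (inj₂ whole) with square-rotation (a ∷ v) a whole
-- a v has length |w| ≥ 2, so it cannot have length 1.
...   | inj₁ |av|≡1 = <-irrefl refl (subst (2 ≤_) (trans (conjugate-length w~av) |av|≡1) 2≤|w|)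
...   | inj₂ (t , av~t , squareInT) = csf t (conjugate-trans w~av av~t) squareInT
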